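{- Let $G$ be a nontrivial connected graph. If there exist two vertices $u$ and $v$ of $G$ having exactly $t\geq 1$ common neighbors, then $pd(G)\geq \lceil t/2\rceil$. Furthermore, if in addition $uv\in E(G)$, then $pd(G)\geq \lceil t/2\rceil+1$.
   Context: All graphs are simple, finite and undirected. For an edge-coloring $c$ of a graph $G$, a set $F\subseteq E(G)$ is a proper cut if $G-F$ is disconnected and any two edges of $F$ sharing an endpoint receive different colors. A proper cut $F$ separates two vertices $x,y$ if $x$ and $y$ lie in different components of $G-F$. An edge-colored graph is proper disconnected if for every pair of distinct vertices there is a proper cut separating them. For a connected graph $G$, the proper disconnection number $pd(G)$ is the minimum $k$ such that there is an edge-coloring $c:E(G)\to\{1,\dots,k\}$ making $G$ proper disconnected. -}

module Defs where

open import Data.Nat using (ℕ; zero; suc; _+_; _≤_)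
open import Data.Fin using (Fin)
open import Data.Bool using (Bool; true; false; _∧_; not; if_then_else_)
open import Data.List using (List; foldr; map; allFin)
open import Data.Product using (Σ; _×_; ∃₂)
open import Relation.Binary.PropositionalEquality using (_≡_; _≢_)
open import Relation.Nullary using (¬_)

record Graph (n : ℕ) : Set where
  field
    adj     : Fin n → Fin n → Bool
    sym     : ∀ x y → adj x y ≡ adj y x
    irrefl  : ∀ x → adj x x ≡ false
open Graph public

data Reach {n : ℕ} (A : Fin n → Fin n → Bool) : Fin n → Fin n → Set where
  here : ∀ {x} → Reach A x x
  step : ∀ {x y z} → A x y ≡ true → Reach A y z → Reach A x z

Connected : ∀ {n} → Graph n → Set
Connected G = ∀ a b → Reach (adj G) a b

-- An edge-coloring with colors Fin k: a color for every (ordered) pair,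
-- required to be symmetric on edges (so it is really a function on E(G)).
record EdgeColoring {n : ℕ} (G : Graph n) (k : ℕ) : Set where
  field
    col    : Fin n → Fin n → Fin k
    colSym : ∀ x y → adj G x y ≡ true → col x y ≡ col y x
open EdgeColoring public

record EdgeSet {n : ℕ} (G : Graph n) : Set where
  field
    mem    : Fin n → Fin n → Bool
    memSym : ∀ x y → mem x y ≡ mem y x
    memSub : ∀ x y → mem x y ≡ true → adj G x y ≡ true
open EdgeSet public

minus : ∀ {n} (G : Graph n) → EdgeSet G → Fin n → Fin n → Bool
minus G F x y = adj G x y ∧ not (mem F x y)

Disconnected : ∀ {n} (A : Fin n → Fin n → Bool) → Set
Disconnected A = ∃₂ λ a b → ¬ Reach A a b

ProperSet : ∀ {n k} {G : Graph n} → EdgeColoring G k → EdgeSet G → Set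
ProperSet c F = ∀ x y z → mem F x y ≡ true → mem F x z ≡ true → y ≢ z →
                col c x y ≢ col c x z

ProperCut : ∀ {n k} {G : Graph n} → EdgeColoring G k → EdgeSet G → Set
ProperCut {G = G} c F = Disconnected (minus G F) × ProperSet c F

Separates : ∀ {n} (G : Graph n) → EdgeSet G → Fin n → Fin n → Set
Separates G F x y = ¬ Reach (minus G F) x y

ProperDisconnected : ∀ {n k} {G : Graph n} → EdgeColoring G k → Set
ProperDisconnected {n} {G = G} c =
  ∀ (x y : Fin n) → x ≢ y → Σ (EdgeSet G) λ F → ProperCut c F × Separates G F x y

-- pd(G) ≥ m  (pd(G) being the minimum k admitting a proper-disconnected
-- k-edge-coloring): every such coloring uses at least m colors.
PdAtLeast : ∀ {n} → Graph n → ℕ → Set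
PdAtLeast G m = ∀ k (c : EdgeColoring G k) → ProperDisconnected c → m ≤ k

commonNbrs : ∀ {n} → Graph n → Fin n → Fin n → ℕ
commonNbrs {n} G u v =
  foldr _+_ 0 (map (λ w → if adj G u w ∧ adj G v w then 1 else 0) (allFin n))

module Submission where

-- Fix a colouring c with k colours making G proper
-- disconnected, and a proper cut F separating u and v.  Every common
-- neighbour w of u and v is joined to u or to v by an edge of F, since
-- otherwise u - w - v would survive in G - F.  Hence the common
-- neighbours are covered by the F-neighbourhoods N_F(u) and N_F(v).
-- Since F is proper, c is injective on the F-edges at u, so
-- |N_F(u)| <= k, and likewise |N_F(v)| <= k; thus t <= 2k.  If moreover
-- uv is an edge, it must lie in F, so v lies in N_F(u) without being a
-- common neighbour (and symmetrically), whence t <= 2(k - 1).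

open import Defs
open import Data.Nat using (ℕ; suc; _+_; _≤_; _<_; ⌈_/2⌉; z≤n; s≤s)
open import Data.Nat.Properties
  using (≤-trans; ≤-reflexive; +-mono-≤; +-monoˡ-≤; +-monoʳ-≤; +-suc; +-comm; n≤1+n; ⌈n/2⌉-mono; n≡⌈n+n/2⌉; module ≤-Reasoning)
open import Data.Fin as Fin using (Fin; _≟_)
open import Data.Fin.Properties using (injective⇒≤)
open import Data.Bool using (Bool; true; false; _∧_; if_then_else_; T)
open import Data.Bool.Properties using (T-≡; T-∧)
open import Data.List using (List; []; _∷_; length; lookup; foldr; map; allFin; filterᵇ)
open import Data.List.Properties using (length-filter; filter-notAll)
open import Data.List.Membership.Propositional using (_∈_; lose)
open import Data.List.Membership.Propositional.Properties using (∈-lookup; ∈-allFin; ∈-filter⁺; ∈-filter⁻)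
import Data.List.Relation.Unary.All as All
open import Data.List.Relation.Unary.AllPairs using (_∷_)
open import Data.List.Relation.Unary.Unique.Propositional using (Unique)
open import Data.List.Relation.Unary.Unique.Propositional.Properties using (allFin⁺; filter⁺)
open import Data.Product using (_×_; _,_; proj₁; proj₂)
open import Data.Sum using (_⊎_; inj₁; inj₂; [_,_]′)
open import Data.Empty using (⊥-elim)
open import Function using (_∘_; id; Equivalence)
open import Relation.Nullary using (¬_)
open import Relation.Nullary.Decidable using (T?; decidable-stable)
open import Relation.Binary.PropositionalEquality using (_≡_; _≢_; refl; trans; cong; subst) renaming (sym to ≡-sym)

open Equivalence using (to; from)

count≡length-filter : ∀ {A : Set} (q : A → Bool) (xs : List A) →
  foldr _+_ 0 (map (λ x → if q x then 1 else 0) xs) ≡ length (filterᵇ q xs)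
count≡length-filter q [] = refl
count≡length-filter q (x ∷ xs) with q x
... | true  = cong suc (count≡length-filter q xs)
... | false = count≡length-filter q xs

filter-cover : ∀ {A : Set} (p a b : A → Bool) →
  (∀ x → T (p x) → T (a x) ⊎ T (b x)) → ∀ xs →
  length (filterᵇ p xs) ≤ length (filterᵇ p (filterᵇ a xs)) + length (filterᵇ p (filterᵇ b xs))
filter-cover p a b cover [] = z≤n
filter-cover p a b cover (x ∷ xs) with a x | b x | cover x
... | true  | true  | _ with p x
...   | true  = s≤s (≤-trans (filter-cover p a b cover xs) (+-monoʳ-≤ _ (n≤1+n _)))
...   | false = filter-cover p a b cover xs
filter-cover p a b cover (x ∷ xs) | true  | false | _ with p x
...   | true  = s≤s (filter-cover p a b cover xs)
...   | false = filter-cover p a b cover xs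
filter-cover p a b cover (x ∷ xs) | false | true  | _ with p x
...   | true  = ≤-trans (s≤s (filter-cover p a b cover xs)) (≤-reflexive (≡-sym (+-suc _ _)))
...   | false = filter-cover p a b cover xs
filter-cover p a b cover (x ∷ xs) | false | false | neither with p x
...   | true  = ⊥-elim ([ id , id ]′ (neither _))
...   | false = filter-cover p a b cover xs

lookup-injective : ∀ {A : Set} {xs : List A} → Unique xs →
  ∀ {i j} → lookup xs i ≡ lookup xs j → i ≡ j
lookup-injective {xs = _ ∷ _} (_ ∷ _) {Fin.zero} {Fin.zero} _ = refl
lookup-injective {xs = _ ∷ _} (x∉ ∷ _) {Fin.zero} {Fin.suc j} e = ⊥-elim (All.lookup x∉ (∈-lookup j) e)
lookup-injective {xs = _ ∷ _} (x∉ ∷ _) {Fin.suc i} {Fin.zero} e = ⊥-elim (All.lookup x∉ (∈-lookup i) (≡-sym e))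
lookup-injective {xs = _ ∷ _} (_ ∷ u) {Fin.suc i} {Fin.suc j} e = cong Fin.suc (lookup-injective u e)

injectiveOn⇒length≤ : ∀ {A : Set} {k} {xs : List A} → Unique xs → (h : A → Fin k) →
  (∀ {x y} → x ∈ xs → y ∈ xs → h x ≡ h y → x ≡ y) → length xs ≤ k
injectiveOn⇒length≤ u h inj =
  injective⇒≤ (λ e → lookup-injective u (inj (∈-lookup _) (∈-lookup _) e))

nbrs : ∀ {n} {G : Graph n} → EdgeSet G → Fin n → List (Fin n)
nbrs {n} F x = filterᵇ (mem F x) (allFin n)

∈-nbrs⁺ : ∀ {n} {G : Graph n} (F : EdgeSet G) {x y} → T (mem F x y) → y ∈ nbrs F x
∈-nbrs⁺ F {x} {y} xy∈F = ∈-filter⁺ (T? ∘ mem F x) (∈-allFin y) xy∈F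

∈-nbrs⁻ : ∀ {n} {G : Graph n} (F : EdgeSet G) {x y} → y ∈ nbrs F x → T (mem F x y)
∈-nbrs⁻ {n} F {x} y∈ = proj₂ (∈-filter⁻ (T? ∘ mem F x) {xs = allFin n} y∈)

common : ∀ {n} → Graph n → Fin n → Fin n → Fin n → Bool
common G u v w = adj G u w ∧ adj G v w

u-not-common : ∀ {n} (G : Graph n) u v → ¬ T (common G u v u)
u-not-common G u v h = subst T (irrefl G u) (proj₁ (to T-∧ h))

v-not-common : ∀ {n} (G : Graph n) u v → ¬ T (common G u v v)
v-not-common G u v h = subst T (irrefl G v) (proj₂ (to T-∧ h))

minus-edge : ∀ {n} (G : Graph n) (F : EdgeSet G) {x y} →
  T (adj G x y) → mem F x y ≡ false → minus G F x y ≡ true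
minus-edge G F xy∈G xy∉F rewrite to T-≡ xy∈G | xy∉F = refl

-- A set F separating u from v contains uw or vw for every common
-- neighbour w, for otherwise u - w - v is a walk in G - F.
separator-meets-common : ∀ {n} (G : Graph n) (F : EdgeSet G) {u v} → Separates G F u v →
  ∀ w → T (common G u v w) → T (mem F u w) ⊎ T (mem F v w)
separator-meets-common G F {u} {v} sep w uw∧vw with mem F u w in uw∉F | mem F v w in vw∉F
... | true  | _     = inj₁ _
... | false | true  = inj₂ _
... | false | false = ⊥-elim (sep (step (minus-edge G F uw uw∉F) (step (minus-edge G F wv wv∉F) here)))
  where
  uw : T (adj G u w)
  uw = proj₁ (to T-∧ uw∧vw)
  wv : T (adj G w v)
  wv = subst T (Graph.sym G v w) (proj₂ (to T-∧ uw∧vw))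
  wv∉F : mem F w v ≡ false
  wv∉F = trans (memSym F w v) vw∉F

separator-contains-edge : ∀ {n} (G : Graph n) (F : EdgeSet G) {u v} → Separates G F u v →
  T (adj G u v) → T (mem F u v)
separator-contains-edge G F {u} {v} sep uv∈G with mem F u v in uv∉F
... | true  = _
... | false = ⊥-elim (sep (step (minus-edge G F uv∈G uv∉F) here))

-- In a proper set F the F-edges at x have distinct colours, so x has at
-- most k F-neighbours.
proper⇒degree≤ : ∀ {n k} {G : Graph n} (c : EdgeColoring G k) (F : EdgeSet G) →
  ProperSet c F → ∀ x → length (nbrs F x) ≤ k
proper⇒degree≤ {n} c F proper x = injectiveOn⇒length≤ nbrs-unique (col c x) colour-injective
  where
  nbrs-unique : Unique (nbrs F x)
  nbrs-unique = filter⁺ (T? ∘ mem F x) (allFin⁺ n)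
  colour-injective : ∀ {y z} → y ∈ nbrs F x → z ∈ nbrs F x → col c x y ≡ col c x z → y ≡ z
  colour-injective y∈ z∈ same = decidable-stable (_ ≟ _) λ y≢z →
    proper x _ _ (to T-≡ (∈-nbrs⁻ F y∈)) (to T-≡ (∈-nbrs⁻ F z∈)) y≢z same

proper⇒filter-nbrs≤ : ∀ {n k} {G : Graph n} (c : EdgeColoring G k) (F : EdgeSet G) →
  ProperSet c F → ∀ (q : Fin n → Bool) x → length (filterᵇ q (nbrs F x)) ≤ k
proper⇒filter-nbrs≤ c F proper q x =
  ≤-trans (length-filter (T? ∘ q) (nbrs F x)) (proper⇒degree≤ c F proper x)

proper⇒filter-nbrs< : ∀ {n k} {G : Graph n} (c : EdgeColoring G k) (F : EdgeSet G) →
  ProperSet c F → ∀ (q : Fin n → Bool) x {y} → y ∈ nbrs F x → ¬ T (q y) →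
  length (filterᵇ q (nbrs F x)) < k
proper⇒filter-nbrs< c F proper q x y∈ ¬qy =
  ≤-trans (filter-notAll (T? ∘ q) (nbrs F x) (lose y∈ ¬qy)) (proper⇒degree≤ c F proper x)

half-bound : ∀ {t a b m} → t ≤ a + b → a ≤ m → b ≤ m → ⌈ t /2⌉ ≤ m
half-bound {t} {m = m} t≤a+b a≤m b≤m =
  subst (⌈ t /2⌉ ≤_) (≡-sym (n≡⌈n+n/2⌉ m)) (⌈n/2⌉-mono (≤-trans t≤a+b (+-mono-≤ a≤m b≤m)))

half-bound-strict : ∀ {t a b k} → t ≤ a + b → a < k → b < k → ⌈ t /2⌉ + 1 ≤ k
half-bound-strict {t} {k = suc m} t≤a+b (s≤s a≤m) (s≤s b≤m) =
  subst (⌈ t /2⌉ + 1 ≤_) (+-comm m 1) (+-monoˡ-≤ 1 (half-bound t≤a+b a≤m b≤m))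

lemma2p6 : ∀ (n : ℕ) (G : Graph n) → 2 ≤ n → Connected G →
    ∀ (u v : Fin n) (t : ℕ) → u ≢ v → 1 ≤ t → commonNbrs G u v ≡ t →
    PdAtLeast G ⌈ t /2⌉ × (adj G u v ≡ true → PdAtLeast G (⌈ t /2⌉ + 1))
lemma2p6 n G _ _ u v t u≢v _ count≡t = pd≥⌈t/2⌉ , pd≥⌈t/2⌉+1
  where
  p : Fin n → Bool
  p = common G u v

  module Cut {k} (c : EdgeColoring G k) (pd : ProperDisconnected c) where
    F : EdgeSet G
    F = proj₁ (pd u v u≢v)
    proper : ProperSet c F
    proper = proj₂ (proj₁ (proj₂ (pd u v u≢v)))
    sep : Separates G F u v
    sep = proj₂ (proj₂ (pd u v u≢v))
    split : t ≤ length (filterᵇ p (nbrs F u)) + length (filterᵇ p (nbrs F v))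
    split = begin
      t                                     ≡⟨ ≡-sym count≡t ⟩
      commonNbrs G u v                      ≡⟨ count≡length-filter p (allFin n) ⟩
      length (filterᵇ p (allFin n))         ≤⟨ filter-cover p (mem F u) (mem F v)
                                                  (separator-meets-common G F sep) (allFin n) ⟩
      length (filterᵇ p (nbrs F u)) + length (filterᵇ p (nbrs F v)) ∎
      where open ≤-Reasoning

  pd≥⌈t/2⌉ : PdAtLeast G ⌈ t /2⌉
  pd≥⌈t/2⌉ k c pd = half-bound split (proper⇒filter-nbrs≤ c F proper p u) (proper⇒filter-nbrs≤ c F proper p v)
    where open Cut c pd

  -- If uv is an edge then uv ∈ F, and v ∈ N_F(u), u ∈ N_F(v) are not
  -- common neighbours, so each side holds fewer than k of them.
  pd≥⌈t/2⌉+1 : adj G u v ≡ true → PdAtLeast G (⌈ t /2⌉ + 1)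
  pd≥⌈t/2⌉+1 uv∈G k c pd = half-bound-strict split
      (proper⇒filter-nbrs< c F proper p u (∈-nbrs⁺ F uv∈F) (v-not-common G u v))
      (proper⇒filter-nbrs< c F proper p v (∈-nbrs⁺ F (subst T (memSym F u v) uv∈F)) (u-not-common G u v))
    where
    open Cut c pd
    uv∈F : T (mem F u v)
    uv∈F = separator-contains-edge G F sep (from T-≡ uv∈G)
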